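{- Let $q\in\mathbb{C}$ with $q\neq1$ be such that $[n]_q\neq 0$ for all $n\geq 1$, let $u,\alpha\in\mathbb{C}$, let $(a_n^{(\alpha)})_{n\ge0}$ be complex numbers with $a_0^{(\alpha)}\neq0$, $(\mathcal{A}_q(t))^{\alpha}=\sum_{n\ge0}a_n^{(\alpha)}\frac{t^n}{[n]_q!}$, and define $\mathrm{P}_{n,q}^{(\alpha)}(x,y;u)$ by $(\mathcal{A}_q(t))^{\alpha}\mathrm{e}_q(tx)\mathrm{e}_q(ty,u)=\sum_{n\ge0}\mathrm{P}_{n,q}^{(\alpha)}(x,y;u)\frac{t^n}{[n]_q!}$. Then for all integers $0\le k\le n$, $$D_{q,x}^{k}\mathrm{P}_{n,q}^{(\alpha)}(x,y;u)=\frac{[n]_q!}{[n-k]_q!}\mathrm{P}_{n-k,q}^{(\alpha)}(x,y;u),\qquad D_{q,y}^{k}\mathrm{P}_{n,q}^{(\alpha)}(x,y;u)=\frac{[n]_q!}{[n-k]_q!}u^{\binom{k}{2}}\mathrm{P}_{n-k,q}^{(\alpha)}(x,u^ky;u).$$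
   Context: $[n]_q=\frac{1-q^n}{1-q}$, $[n]_q!=[1]_q\cdots[n]_q$ ($[0]_q!=1$). $\mathrm{e}_q(z,u)=\sum_{n\ge0}u^{\binom{n}{2}}\frac{z^n}{[n]_q!}$ (convention $0^0=1$), $\mathrm{e}_q(z)=\mathrm{e}_q(z,1)$. $D_qf(x)=\frac{f(x)-f(qx)}{(1-q)x}$; $D_{q,x}$, $D_{q,y}$ act on the variable $x$, resp. $y$; $D^k$ denotes $k$-fold iteration ($D^0$ the identity). -}

module Defs where

open import Level using (_⊔_)
open import Data.Nat using (ℕ; zero; suc; _∸_)
import Data.Nat
import Relation.Nullary
open import Algebra.Apartness.Bundles using (HeytingField)

module _ {c ℓ₁ ℓ₂} (K : HeytingField c ℓ₁ ℓ₂) where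
  open HeytingField K

  pow : Carrier → ℕ → Carrier
  pow x zero    = 1#
  pow x (suc n) = x * pow x n

  sumTo : ℕ → (ℕ → Carrier) → Carrier
  sumTo zero    f = f 0
  sumTo (suc n) f = sumTo n f + f (suc n)

  -- [n]_q = 1 + q + ... + q^(n-1)  ( = (1 - q^n)/(1 - q) for q ≠ 1 )
  qint : Carrier → ℕ → Carrier
  qint q zero    = 0#
  qint q (suc n) = qint q n + pow q n

  qfact : Carrier → ℕ → Carrier
  qfact q zero    = 1#
  qfact q (suc n) = qfact q n * qint q (suc n)

  -- [n]_q! / [n-k]_q! = [n]_q [n-1]_q ... [n-k+1]_q   (for k ≤ n)
  qfall : Carrier → ℕ → ℕ → Carrier
  qfall q n zero    = 1#
  qfall q n (suc k) = qfall q n k * qint q (n ∸ k)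

  -- polynomials in x, y over K, as coefficient functions: p i j = coeff of x^i y^j
  Poly2 : Set c
  Poly2 = ℕ → ℕ → Carrier

  _≈P_ : Poly2 → Poly2 → Set ℓ₁
  p ≈P r = ∀ i j → p i j ≈ r i j

  _+P_ : Poly2 → Poly2 → Poly2
  (p +P r) i j = p i j + r i j

  _*P_ : Poly2 → Poly2 → Poly2
  (p *P r) i j = sumTo i (λ a → sumTo j (λ b → p a b * r (i ∸ a) (j ∸ b)))

  _⊙_ : Carrier → Poly2 → Poly2
  (s ⊙ p) i j = s * p i j

  0P : Poly2
  0P i j = 0#

  mono : Carrier → ℕ → ℕ → Poly2
  mono s m l i j with Data.Nat._≟_ i m | Data.Nat._≟_ j l
  ... | Relation.Nullary.yes _ | Relation.Nullary.yes _ = s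
  ... | _ | _ = 0#

  -- formal power series in t with coefficients in K[x,y]: F n = coeff of t^n
  Series : Set c
  Series = ℕ → Poly2

  sumToP : ℕ → (ℕ → Poly2) → Poly2
  sumToP zero    f = f 0
  sumToP (suc n) f = sumToP n f +P f (suc n)

  _⋆_ : Series → Series → Series
  (F ⋆ G) n = sumToP n (λ m → F m *P G (n ∸ m))

  -- q-derivatives in x and y, acting on polynomials: D_q x^i = [i]_q x^(i-1)
  Dx : Carrier → Poly2 → Poly2
  Dx q p i j = qint q (suc i) * p (suc i) j

  Dy : Carrier → Poly2 → Poly2
  Dy q p i j = qint q (suc j) * p i (suc j)

  iter : ℕ → (Poly2 → Poly2) → Poly2 → Poly2
  iter zero    f p = p
  iter (suc k) f p = f (iter k f p)

  -- substitution y ↦ s·y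
  substY : Carrier → Poly2 → Poly2
  substY s p i j = pow s j * p i j

choose2 : ℕ → ℕ
choose2 zero    = 0
choose2 (suc n) = n Data.Nat.+ choose2 n

{-# OPTIONS --safe #-}
-- Comparing coefficients of t^n x^i y^j: with r = n - i - j, the coefficient of x^i y^j in P_n is
-- [n]! a_r u^(j choose 2) / ([r]! [i]! [j]!), and it is 0 when i + j > n.  So D_{q,x} only acts on
-- the factor e_q(tx), where [i+1] / [i+1]! = 1 / [i]!, and D_{q,y} only on e_q(ty,u), where
-- moreover u^((j+1) choose 2) = u^j u^(j choose 2) produces the substitution y ↦ u y; either way
-- P_{n+1} turns into [n+1] times P_n.  The k-fold formulas follow by induction on k, since D_{q,y}
-- commutes with y ↦ s y up to the factor s.
module Submission where

open import Defs
open import Data.Nat using (ℕ; _≤_; _∸_)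
open import Data.Product using (_×_)
open import Algebra.Apartness.Bundles using (HeytingField)

open import Data.Nat as ℕ using (zero; suc; z≤n; s≤s; _≟_; _≤?_)
open import Data.Nat.Properties as ℕₚ
  using (≤-refl; ≤-pred; ≤-antisym; m≤n⇒m≤1+n; m∸n≡0⇒m≤n; m∸n≤m; m∸[m∸n]≡n; n∸n≡0; ∸-+-assoc;
         +-∸-assoc; +-suc; m+n≤o⇒n≤o; m+n≤o⇒m≤o∸n; m≤o∸n⇒m+n≤o)
open import Data.Product using (_,_)
open import Data.Sum using (_⊎_; inj₁; inj₂; [_,_])
open import Function using (_∘_)
open import Relation.Nullary using (¬_; yes; no; contradiction)
open import Relation.Binary.PropositionalEquality as ≡ using (_≡_; _≢_)
open import Relation.Binary.Bundles using (Setoid)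
open import Algebra.Apartness.Bundles using (HeytingCommutativeRing)
open import Algebra.Bundles using (CommutativeRing)
import Algebra.Apartness.Properties.HeytingCommutativeRing as HeytingCommutativeRingProperties
import Algebra.Properties.CommutativeSemigroup as CommutativeSemigroupProperties
import Algebra.Solver.CommutativeMonoid as CommutativeMonoidSolver
import Relation.Binary.Reasoning.Setoid as SetoidReasoning

module _ {c ℓ₁ ℓ₂} (K : HeytingField c ℓ₁ ℓ₂) where
  open HeytingField K hiding (zero)
  open HeytingCommutativeRingProperties heytingCommutativeRing using (1#0; x#0y#0→xy#0; x-0≈x)
  open CommutativeRing (HeytingCommutativeRing.commutativeRing heytingCommutativeRing)
    using (*-commutativeSemigroup; *-commutativeMonoid)
  open CommutativeSemigroupProperties *-commutativeSemigroup
    using (interchange; x∙yz≈y∙xz; x∙yz≈yx∙z; xy∙z≈y∙xz)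

  module ≈-Reasoning = SetoidReasoning setoid

  x≈0⇒x*y≈0 : ∀ {x} y → x ≈ 0# → x * y ≈ 0#
  x≈0⇒x*y≈0 y x≈0 = trans (*-congʳ x≈0) (zeroˡ y)

  y≈0⇒x*y≈0 : ∀ x {y} → y ≈ 0# → x * y ≈ 0#
  y≈0⇒x*y≈0 x y≈0 = trans (*-congˡ y≈0) (zeroʳ x)

  *-cancelˡ-# : ∀ {z x y} → z # 0# → z * x ≈ z * y → x ≈ y
  *-cancelˡ-# {z} {x} {y} z#0 zx≈zy with #⇒invertible z#0
  ... | z⁻¹ , z⁻¹[z-0]≈1 , _ = begin
    x              ≈⟨ *-identityˡ x ⟨
    1# * x         ≈⟨ *-congʳ z⁻¹z≈1 ⟨
    z⁻¹ * z * x    ≈⟨ *-assoc z⁻¹ z x ⟩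
    z⁻¹ * (z * x)  ≈⟨ *-congˡ zx≈zy ⟩
    z⁻¹ * (z * y)  ≈⟨ *-assoc z⁻¹ z y ⟨
    z⁻¹ * z * y    ≈⟨ *-congʳ z⁻¹z≈1 ⟩
    1# * y         ≈⟨ *-identityˡ y ⟩
    y              ∎
    where
    open ≈-Reasoning
    z⁻¹z≈1 : z⁻¹ * z ≈ 1#
    z⁻¹z≈1 = trans (*-congˡ (sym (x-0≈x z))) z⁻¹[z-0]≈1

  pow-homo-* : ∀ x m n → pow K x (m ℕ.+ n) ≈ pow K x m * pow K x n
  pow-homo-* x zero    n = sym (*-identityˡ _)
  pow-homo-* x (suc m) n = trans (*-congˡ (pow-homo-* x m n)) (sym (*-assoc _ _ _))

  pow-distrib-* : ∀ x y n → pow K (x * y) n ≈ pow K x n * pow K y n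
  pow-distrib-* x y zero    = sym (*-identityˡ 1#)
  pow-distrib-* x y (suc n) = trans (*-congˡ (pow-distrib-* x y n)) (interchange x y _ _)

  pow-1# : ∀ n → pow K 1# n ≈ 1#
  pow-1# zero    = refl
  pow-1# (suc n) = trans (*-identityˡ _) (pow-1# n)

  qfact-#0 : ∀ {q} → (∀ n → 1 ≤ n → qint K q n # 0#) → ∀ n → qfact K q n # 0#
  qfact-#0 qint#0 zero    = 1#0
  qfact-#0 qint#0 (suc n) = x#0y#0→xy#0 (qfact-#0 qint#0 n) (qint#0 (suc n) (s≤s z≤n))

  -- [n+1]_q · (s t / [n+1]_q!) = s · (t / [n]_q!), phrased without division.
  divided-power-step : ∀ {q} n {s t x′ x} → qfact K q n # 0# →
    qfact K q (suc n) * x′ ≈ s * t → qfact K q n * x ≈ t → qint K q (suc n) * x′ ≈ s * x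
  divided-power-step {q} n {s} {t} {x′} {x} [n]!#0 [n+1]!x′≈st [n]!x≈t = *-cancelˡ-# [n]!#0 (begin
    qfact K q n * (qint K q (suc n) * x′)  ≈⟨ *-assoc _ _ _ ⟨
    qfact K q (suc n) * x′                 ≈⟨ [n+1]!x′≈st ⟩
    s * t                                  ≈⟨ *-congˡ [n]!x≈t ⟨
    s * (qfact K q n * x)                  ≈⟨ x∙yz≈y∙xz s _ x ⟩
    qfact K q n * (s * x)                  ∎)
    where open ≈-Reasoning

  sumTo-zero : ∀ n {f} → (∀ i → i ≤ n → f i ≈ 0#) → sumTo K n f ≈ 0#
  sumTo-zero zero    f≈0 = f≈0 0 z≤n
  sumTo-zero (suc n) f≈0 =
    trans (+-cong (sumTo-zero n (λ i → f≈0 i ∘ m≤n⇒m≤1+n)) (f≈0 (suc n) ≤-refl)) (+-identityˡ 0#)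

  sumTo-single : ∀ n m {f} → m ≤ n → (∀ i → i ≤ n → i ≢ m → f i ≈ 0#) → sumTo K n f ≈ f m
  sumTo-single zero    .zero z≤n _ = refl
  sumTo-single (suc n) m     m≤1+n f≈0 with m ≟ suc n
  ... | yes ≡.refl = trans (+-congʳ (sumTo-zero n λ i i≤n → f≈0 i (m≤n⇒m≤1+n i≤n) (i≢1+n i≤n)))
                           (+-identityˡ _)
    where
    i≢1+n : ∀ {i} → i ≤ n → i ≢ suc n
    i≢1+n i≤n ≡.refl = ℕₚ.<-irrefl ≡.refl (s≤s i≤n)
  ... | no m≢1+n = trans (+-cong (sumTo-single n m m≤n (λ i → f≈0 i ∘ m≤n⇒m≤1+n))
                                 (f≈0 (suc n) ≤-refl (m≢1+n ∘ ≡.sym)))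
                         (+-identityʳ _)
    where
    m≤n : m ≤ n
    m≤n = ≤-pred (ℕₚ.≤∧≢⇒< m≤1+n m≢1+n)

  sumToP-apply : ∀ n F i j → sumToP K n F i j ≡ sumTo K n (λ m → F m i j)
  sumToP-apply zero    F i j = ≡.refl
  sumToP-apply (suc n) F i j = ≡.cong (_+ F (suc n) i j) (sumToP-apply n F i j)

  infix  4 _≈ₚ_
  infixr 6 _⊙ₚ_
  infixl 7 _*ₚ_ _⋆ₚ_

  _≈ₚ_ : Poly2 K → Poly2 K → Set ℓ₁
  _≈ₚ_ = _≈P_ K

  _⊙ₚ_ : Carrier → Poly2 K → Poly2 K
  _⊙ₚ_ = _⊙_ K

  _*ₚ_ : Poly2 K → Poly2 K → Poly2 K
  _*ₚ_ = _*P_ K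

  _⋆ₚ_ : Series K → Series K → Series K
  _⋆ₚ_ = _⋆_ K

  ≈ₚ-setoid : Setoid c ℓ₁
  ≈ₚ-setoid = record
    { Carrier       = Poly2 K
    ; _≈_           = _≈ₚ_
    ; isEquivalence = record
      { refl  = λ _ _ → refl
      ; sym   = λ p≈r i j → sym (p≈r i j)
      ; trans = λ p≈r r≈s i j → trans (p≈r i j) (r≈s i j)
      }
    }

  module ≈ₚ-Reasoning = SetoidReasoning ≈ₚ-setoid

  IsMonomial : ℕ → ℕ → Poly2 K → Set ℓ₁
  IsMonomial m l p = ∀ i j → i ≢ m ⊎ j ≢ l → p i j ≈ 0#

  FreeOfX : Poly2 K → Set ℓ₁
  FreeOfX p = ∀ i j → i ≢ 0 → p i j ≈ 0#

  FreeOfY : Poly2 K → Set ℓ₁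
  FreeOfY p = ∀ i j → j ≢ 0 → p i j ≈ 0#

  mono-at : ∀ s m l → mono K s m l m l ≈ s
  mono-at s m l with m ≟ m | l ≟ l
  ... | yes _   | yes _   = refl
  ... | no m≢m  | _       = contradiction ≡.refl m≢m
  ... | yes _   | no l≢l  = contradiction ≡.refl l≢l

  mono-isMonomial : ∀ s m l → IsMonomial m l (mono K s m l)
  mono-isMonomial s m l i j i≢m⊎j≢l with i ≟ m | j ≟ l
  ... | yes i≡m | yes j≡l = [ contradiction i≡m , contradiction j≡l ] i≢m⊎j≢l
  ... | yes _   | no _    = refl
  ... | no _    | _       = refl

  ⊙ₚ-mono⇒isMonomial : ∀ {d p s m l} → d # 0# → d ⊙ₚ p ≈ₚ mono K s m l → IsMonomial m l p
  ⊙ₚ-mono⇒isMonomial {d} {s = s} {m} {l} d#0 dp≈mono i j off =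
    *-cancelˡ-# d#0 (trans (dp≈mono i j) (trans (mono-isMonomial s m l i j off) (sym (zeroʳ d))))

  *ₚ-constantˡ : ∀ {p} r → IsMonomial 0 0 p → ∀ i j → (p *ₚ r) i j ≈ p 0 0 * r i j
  *ₚ-constantˡ {p} r p-monomial i j = trans
    (sumTo-single i 0 z≤n λ a _ a≢0 → sumTo-zero j λ b _ → x≈0⇒x*y≈0 _ (p-monomial a b (inj₁ a≢0)))
    (sumTo-single j 0 z≤n λ b _ b≢0 → x≈0⇒x*y≈0 _ (p-monomial 0 b (inj₂ b≢0)))

  *ₚ-separated : ∀ {p r} → FreeOfY p → FreeOfX r → ∀ i j → (p *ₚ r) i j ≈ p i 0 * r 0 j
  *ₚ-separated {p} {r} p-free r-free i j = begin
    (p *ₚ r) i j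
      ≈⟨ sumTo-single i i ≤-refl (λ a a≤i a≢i → sumTo-zero j λ b _ →
           y≈0⇒x*y≈0 _ (r-free (i ∸ a) (j ∸ b) (a≢i ∘ ≤-antisym a≤i ∘ m∸n≡0⇒m≤n))) ⟩
    sumTo K j (λ b → p i b * r (i ∸ i) (j ∸ b))
      ≈⟨ sumTo-single j 0 z≤n (λ b _ b≢0 → x≈0⇒x*y≈0 _ (p-free i b b≢0)) ⟩
    p i 0 * r (i ∸ i) j
      ≡⟨ ≡.cong (λ k → p i 0 * r k j) (n∸n≡0 i) ⟩
    p i 0 * r 0 j ∎
    where open ≈-Reasoning

  ⋆ₚ-vanishes : ∀ F G n i j → (∀ m → m ≤ n → (F m *ₚ G (n ∸ m)) i j ≈ 0#) → (F ⋆ₚ G) n i j ≈ 0#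
  ⋆ₚ-vanishes F G n i j terms≈0 = trans (reflexive (sumToP-apply n _ i j)) (sumTo-zero n terms≈0)

  ⋆ₚ-single : ∀ F G {d} n i j → (∀ m k → k ≢ d → (F m *ₚ G k) i j ≈ 0#) →
    d ≤ n → (F ⋆ₚ G) n i j ≈ (F (n ∸ d) *ₚ G d) i j
  ⋆ₚ-single F G {d} n i j only-d d≤n = begin
    (F ⋆ₚ G) n i j
      ≡⟨ sumToP-apply n _ i j ⟩
    sumTo K n (λ m → (F m *ₚ G (n ∸ m)) i j)
      ≈⟨ sumTo-single n (n ∸ d) (m∸n≤m n d) (λ m m≤n m≢n∸d → only-d m (n ∸ m) λ n∸m≡d →
           m≢n∸d (≡.trans (≡.sym (m∸[m∸n]≡n m≤n)) (≡.cong (n ∸_) n∸m≡d))) ⟩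
    (F (n ∸ d) *ₚ G (n ∸ (n ∸ d))) i j
      ≡⟨ ≡.cong (λ k → (F (n ∸ d) *ₚ G k) i j) (m∸[m∸n]≡n d≤n) ⟩
    (F (n ∸ d) *ₚ G d) i j ∎
    where open ≈-Reasoning

  ⋆ₚ-single-vanishes : ∀ F G {d} n i j → (∀ m k → k ≢ d → (F m *ₚ G k) i j ≈ 0#) →
    ¬ d ≤ n → (F ⋆ₚ G) n i j ≈ 0#
  ⋆ₚ-single-vanishes F G n i j only-d d≰n = ⋆ₚ-vanishes F G n i j λ m _ →
    only-d m (n ∸ m) λ n∸m≡d → d≰n (≡.subst (_≤ n) n∸m≡d (m∸n≤m n m))

  ⊙ₚ-congˡ : ∀ s {p r} → p ≈ₚ r → s ⊙ₚ p ≈ₚ s ⊙ₚ r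
  ⊙ₚ-congˡ s p≈r i j = *-congˡ (p≈r i j)

  ⊙ₚ-congʳ : ∀ {s t} p → s ≈ t → s ⊙ₚ p ≈ₚ t ⊙ₚ p
  ⊙ₚ-congʳ p s≈t i j = *-congʳ s≈t

  ⊙ₚ-assoc : ∀ s t p → s * t ⊙ₚ p ≈ₚ s ⊙ₚ t ⊙ₚ p
  ⊙ₚ-assoc s t p i j = *-assoc s t (p i j)

  substY-cong : ∀ s {p r} → p ≈ₚ r → substY K s p ≈ₚ substY K s r
  substY-cong s p≈r i j = *-congˡ (p≈r i j)

  substY-⊙ₚ : ∀ s t p → substY K s (t ⊙ₚ p) ≈ₚ t ⊙ₚ substY K s p
  substY-⊙ₚ s t p i j = x∙yz≈y∙xz _ t (p i j)

  substY-substY : ∀ s t p → substY K s (substY K t p) ≈ₚ substY K (t * s) p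
  substY-substY s t p i j = begin
    pow K s j * (pow K t j * p i j)  ≈⟨ x∙yz≈yx∙z _ _ _ ⟩
    pow K t j * pow K s j * p i j    ≈⟨ *-congʳ (pow-distrib-* t s j) ⟨
    pow K (t * s) j * p i j          ∎
    where open ≈-Reasoning

  Dx-cong : ∀ q {p r} → p ≈ₚ r → Dx K q p ≈ₚ Dx K q r
  Dx-cong q p≈r i j = *-congˡ (p≈r (suc i) j)

  Dx-⊙ₚ : ∀ q s p → Dx K q (s ⊙ₚ p) ≈ₚ s ⊙ₚ Dx K q p
  Dx-⊙ₚ q s p i j = x∙yz≈y∙xz _ s _

  Dy-cong : ∀ q {p r} → p ≈ₚ r → Dy K q p ≈ₚ Dy K q r
  Dy-cong q p≈r i j = *-congˡ (p≈r i (suc j))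

  Dy-⊙ₚ : ∀ q s p → Dy K q (s ⊙ₚ p) ≈ₚ s ⊙ₚ Dy K q p
  Dy-⊙ₚ q s p i j = x∙yz≈y∙xz _ s _

  Dy-substY : ∀ q s p → Dy K q (substY K s p) ≈ₚ s ⊙ₚ substY K s (Dy K q p)
  Dy-substY q s p i j = trans (x∙yz≈y∙xz _ _ _) (*-assoc s _ _)

  module Appell
    (q u : Carrier) (qint#0 : ∀ n → 1 ≤ n → qint K q n # 0#)
    (a : ℕ → Carrier) (P : ℕ → Poly2 K) (A X Y PS : Series K)
    (A-def  : ∀ n → qfact K q n ⊙ₚ A n ≈ₚ mono K (a n) 0 0)
    (X-def  : ∀ n → qfact K q n ⊙ₚ X n ≈ₚ mono K 1# n 0)
    (Y-def  : ∀ n → qfact K q n ⊙ₚ Y n ≈ₚ mono K (pow K u (choose2 n)) 0 n)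
    (P-def  : ∀ n → qfact K q n ⊙ₚ PS n ≈ₚ P n)
    (PS-def : ∀ n → PS n ≈ₚ (A ⋆ₚ X ⋆ₚ Y) n)
    where

    [_]q : ℕ → Carrier
    [ n ]q = qint K q n

    [_]! : ℕ → Carrier
    [ n ]! = qfact K q n

    [_]!-#0 : ∀ n → [ n ]! # 0#
    [_]!-#0 = qfact-#0 qint#0

    A-monomial : ∀ n → IsMonomial 0 0 (A n)
    A-monomial n = ⊙ₚ-mono⇒isMonomial [ n ]!-#0 (A-def n)

    X-monomial : ∀ n → IsMonomial n 0 (X n)
    X-monomial n = ⊙ₚ-mono⇒isMonomial [ n ]!-#0 (X-def n)

    Y-monomial : ∀ n → IsMonomial 0 n (Y n)
    Y-monomial n = ⊙ₚ-mono⇒isMonomial [ n ]!-#0 (Y-def n)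

    X-coeff : ∀ n → [ n ]! * X n n 0 ≈ 1#
    X-coeff n = trans (X-def n n 0) (mono-at 1# n 0)

    Y-coeff : ∀ n → [ n ]! * Y n 0 n ≈ pow K u (choose2 n)
    Y-coeff n = trans (Y-def n 0 n) (mono-at _ 0 n)

    X-shift : ∀ i → [ suc i ]q * X (suc i) (suc i) 0 ≈ X i i 0
    X-shift i = trans (divided-power-step i [ i ]!-#0 (trans (X-coeff (suc i)) (sym (*-identityˡ 1#)))
                                                        (X-coeff i))
                      (*-identityˡ _)

    Y-shift : ∀ j → [ suc j ]q * Y (suc j) 0 (suc j) ≈ pow K u j * Y j 0 j
    Y-shift j = divided-power-step j [ j ]!-#0 (trans (Y-coeff (suc j)) (pow-homo-* u j (choose2 j)))
                                               (Y-coeff j)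

    AX : Series K
    AX = A ⋆ₚ X

    AX-term : ∀ m k i j → (A m *ₚ X k) i j ≈ A m 0 0 * X k i j
    AX-term m k = *ₚ-constantˡ (X k) (A-monomial m)

    AX-term-off : ∀ i j m k → k ≢ i → (A m *ₚ X k) i j ≈ 0#
    AX-term-off i j m k k≢i =
      trans (AX-term m k i j) (y≈0⇒x*y≈0 _ (X-monomial k i j (inj₁ (k≢i ∘ ≡.sym))))

    AX-freeOfY : ∀ n → FreeOfY (AX n)
    AX-freeOfY n i j j≢0 = ⋆ₚ-vanishes A X n i j λ m _ →
      trans (AX-term m (n ∸ m) i j) (y≈0⇒x*y≈0 _ (X-monomial (n ∸ m) i j (inj₂ j≢0)))

    AX-coeff : ∀ n i → i ≤ n → AX n i 0 ≈ A (n ∸ i) 0 0 * X i i 0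
    AX-coeff n i i≤n = trans (⋆ₚ-single A X n i 0 (AX-term-off i 0) i≤n) (AX-term (n ∸ i) i i 0)

    AX-vanishes : ∀ n i → ¬ i ≤ n → AX n i 0 ≈ 0#
    AX-vanishes n i = ⋆ₚ-single-vanishes A X n i 0 (AX-term-off i 0)

    PS-term : ∀ m k i j → (AX m *ₚ Y k) i j ≈ AX m i 0 * Y k 0 j
    PS-term m k = *ₚ-separated (AX-freeOfY m) (λ i j i≢0 → Y-monomial k i j (inj₁ i≢0))

    PS-term-off : ∀ i j m k → k ≢ j → (AX m *ₚ Y k) i j ≈ 0#
    PS-term-off i j m k k≢j =
      trans (PS-term m k i j) (y≈0⇒x*y≈0 _ (Y-monomial k 0 j (inj₂ (k≢j ∘ ≡.sym))))

    PS-via-AX : ∀ n i j → j ≤ n → PS n i j ≈ AX (n ∸ j) i 0 * Y j 0 j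
    PS-via-AX n i j j≤n =
      trans (PS-def n i j) (trans (⋆ₚ-single AX Y n i j (PS-term-off i j) j≤n) (PS-term (n ∸ j) j i j))

    PS-coeff : ∀ n i j → i ℕ.+ j ≤ n → PS n i j ≈ A (n ∸ (i ℕ.+ j)) 0 0 * X i i 0 * Y j 0 j
    PS-coeff n i j i+j≤n = begin
      PS n i j
        ≈⟨ PS-via-AX n i j (m+n≤o⇒n≤o i i+j≤n) ⟩
      AX (n ∸ j) i 0 * Y j 0 j
        ≈⟨ *-congʳ (AX-coeff (n ∸ j) i (m+n≤o⇒m≤o∸n i i+j≤n)) ⟩
      A (n ∸ j ∸ i) 0 0 * X i i 0 * Y j 0 j
        ≡⟨ ≡.cong (λ r → A r 0 0 * X i i 0 * Y j 0 j) n∸j∸i≡n∸[i+j] ⟩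
      A (n ∸ (i ℕ.+ j)) 0 0 * X i i 0 * Y j 0 j ∎
      where
      open ≈-Reasoning
      n∸j∸i≡n∸[i+j] : n ∸ j ∸ i ≡ n ∸ (i ℕ.+ j)
      n∸j∸i≡n∸[i+j] = ≡.trans (∸-+-assoc n j i) (≡.cong (n ∸_) (ℕₚ.+-comm j i))

    PS-vanishes : ∀ n i j → ¬ i ℕ.+ j ≤ n → PS n i j ≈ 0#
    PS-vanishes n i j i+j≰n with j ≤? n
    ... | no j≰n  = trans (PS-def n i j) (⋆ₚ-single-vanishes AX Y n i j (PS-term-off i j) j≰n)
    ... | yes j≤n = trans (PS-via-AX n i j j≤n)
                          (x≈0⇒x*y≈0 _ (AX-vanishes (n ∸ j) i (i+j≰n ∘ m≤o∸n⇒m+n≤o i j≤n)))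

    PS-Dx-shift : ∀ m i j → [ suc i ]q * PS (suc m) (suc i) j ≈ PS m i j
    PS-Dx-shift m i j with i ℕ.+ j ≤? m
    ... | yes i+j≤m = begin
      [ suc i ]q * PS (suc m) (suc i) j
        ≈⟨ *-congˡ (PS-coeff (suc m) (suc i) j (s≤s i+j≤m)) ⟩
      [ suc i ]q * (A r 0 0 * X (suc i) (suc i) 0 * Y j 0 j)
        ≈⟨ *-assoc _ _ _ ⟨
      [ suc i ]q * (A r 0 0 * X (suc i) (suc i) 0) * Y j 0 j
        ≈⟨ *-congʳ (trans (x∙yz≈y∙xz _ _ _) (*-congˡ (X-shift i))) ⟩
      A r 0 0 * X i i 0 * Y j 0 j
        ≈⟨ PS-coeff m i j i+j≤m ⟨
      PS m i j ∎
      where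
      open ≈-Reasoning
      r : ℕ
      r = m ∸ (i ℕ.+ j)
    ... | no i+j≰m = trans (y≈0⇒x*y≈0 _ (PS-vanishes (suc m) (suc i) j (i+j≰m ∘ ≤-pred)))
                           (sym (PS-vanishes m i j i+j≰m))

    PS-Dy-shift : ∀ m i j → [ suc j ]q * PS (suc m) i (suc j) ≈ pow K u j * PS m i j
    PS-Dy-shift m i j with i ℕ.+ j ≤? m
    ... | yes i+j≤m = begin
      [ suc j ]q * PS (suc m) i (suc j)
        ≈⟨ *-congˡ (PS-coeff (suc m) i (suc j) i+[1+j]≤1+m) ⟩
      [ suc j ]q * (A (suc m ∸ (i ℕ.+ suc j)) 0 0 * X i i 0 * Y (suc j) 0 (suc j))
        ≡⟨ ≡.cong (λ r′ → [ suc j ]q * (A r′ 0 0 * X i i 0 * Y (suc j) 0 (suc j))) 1+m∸[i+1+j]≡r ⟩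
      [ suc j ]q * (A r 0 0 * X i i 0 * Y (suc j) 0 (suc j))
        ≈⟨ x∙yz≈y∙xz _ _ _ ⟩
      A r 0 0 * X i i 0 * ([ suc j ]q * Y (suc j) 0 (suc j))
        ≈⟨ *-congˡ (Y-shift j) ⟩
      A r 0 0 * X i i 0 * (pow K u j * Y j 0 j)
        ≈⟨ x∙yz≈y∙xz _ _ _ ⟩
      pow K u j * (A r 0 0 * X i i 0 * Y j 0 j)
        ≈⟨ *-congˡ (PS-coeff m i j i+j≤m) ⟨
      pow K u j * PS m i j ∎
      where
      open ≈-Reasoning
      r : ℕ
      r = m ∸ (i ℕ.+ j)
      i+[1+j]≤1+m : i ℕ.+ suc j ≤ suc m
      i+[1+j]≤1+m = ≡.subst (_≤ suc m) (≡.sym (+-suc i j)) (s≤s i+j≤m)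
      1+m∸[i+1+j]≡r : suc m ∸ (i ℕ.+ suc j) ≡ r
      1+m∸[i+1+j]≡r = ≡.cong (suc m ∸_) (+-suc i j)
    ... | no i+j≰m = trans (y≈0⇒x*y≈0 _ (PS-vanishes (suc m) i (suc j) i+[1+j]≰1+m))
                           (sym (y≈0⇒x*y≈0 _ (PS-vanishes m i j i+j≰m)))
      where
      i+[1+j]≰1+m : ¬ i ℕ.+ suc j ≤ suc m
      i+[1+j]≰1+m = i+j≰m ∘ ≤-pred ∘ ≡.subst (_≤ suc m) (+-suc i j)

    P-shift : ∀ m {i′ j′ i j t s} → t * PS (suc m) i′ j′ ≈ s * PS m i j →
      t * P (suc m) i′ j′ ≈ [ suc m ]q * (s * P m i j)
    P-shift m {i′} {j′} {i} {j} {t} {s} PS-shift = begin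
      t * P (suc m) i′ j′                      ≈⟨ *-congˡ (P-def (suc m) i′ j′) ⟨
      t * ([ suc m ]! * PS (suc m) i′ j′)      ≈⟨ x∙yz≈y∙xz t _ _ ⟩
      [ suc m ]! * (t * PS (suc m) i′ j′)      ≈⟨ *-congˡ PS-shift ⟩
      [ m ]! * [ suc m ]q * (s * PS m i j)     ≈⟨ xy∙z≈y∙xz _ _ _ ⟩
      [ suc m ]q * ([ m ]! * (s * PS m i j))   ≈⟨ *-congˡ (x∙yz≈y∙xz _ s _) ⟩
      [ suc m ]q * (s * ([ m ]! * PS m i j))   ≈⟨ *-congˡ (*-congˡ (P-def m i j)) ⟩
      [ suc m ]q * (s * P m i j)               ∎
      where open ≈-Reasoning

    Dx-P : ∀ {n m} → n ≡ suc m → Dx K q (P n) ≈ₚ [ n ]q ⊙ₚ P m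
    Dx-P {m = m} ≡.refl i j =
      trans (P-shift m (trans (PS-Dx-shift m i j) (sym (*-identityˡ _)))) (*-congˡ (*-identityˡ _))

    Dy-P : ∀ {n m} → n ≡ suc m → Dy K q (P n) ≈ₚ [ n ]q ⊙ₚ substY K u (P m)
    Dy-P {m = m} ≡.refl i j = P-shift m (PS-Dy-shift m i j)

    iter-Dx-P : ∀ n k → k ≤ n → iter K k (Dx K q) (P n) ≈ₚ qfall K q n k ⊙ₚ P (n ∸ k)
    iter-Dx-P n       zero    _         i j = sym (*-identityˡ _)
    iter-Dx-P (suc n) (suc k) (s≤s k≤n) = begin
      Dx K q (iter K k (Dx K q) (P (suc n)))
        ≈⟨ Dx-cong q (iter-Dx-P (suc n) k (m≤n⇒m≤1+n k≤n)) ⟩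
      Dx K q (qfall K q (suc n) k ⊙ₚ P (suc n ∸ k))
        ≈⟨ Dx-⊙ₚ q _ (P (suc n ∸ k)) ⟩
      qfall K q (suc n) k ⊙ₚ Dx K q (P (suc n ∸ k))
        ≈⟨ ⊙ₚ-congˡ _ (Dx-P (+-∸-assoc 1 k≤n)) ⟩
      qfall K q (suc n) k ⊙ₚ [ suc n ∸ k ]q ⊙ₚ P (n ∸ k)
        ≈⟨ ⊙ₚ-assoc _ _ _ ⟨
      qfall K q (suc n) k * [ suc n ∸ k ]q ⊙ₚ P (n ∸ k) ∎
      where open ≈ₚ-Reasoning

    iter-Dy-P : ∀ n k → k ≤ n →
      iter K k (Dy K q) (P n) ≈ₚ qfall K q n k * pow K u (choose2 k) ⊙ₚ substY K (pow K u k) (P (n ∸ k))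
    iter-Dy-P n       zero    _         i j = sym (trans (*-cong (*-identityˡ 1#) (*-congʳ (pow-1# j)))
                                                         (trans (*-identityˡ _) (*-identityˡ _)))
    iter-Dy-P (suc n) (suc k) (s≤s k≤n) = begin
      Dy K q (iter K k (Dy K q) (P (suc n)))
        ≈⟨ Dy-cong q (iter-Dy-P (suc n) k (m≤n⇒m≤1+n k≤n)) ⟩
      Dy K q (cₖ ⊙ₚ substY K uᵏ (P (suc n ∸ k)))
        ≈⟨ Dy-⊙ₚ q cₖ (substY K uᵏ (P (suc n ∸ k))) ⟩
      cₖ ⊙ₚ Dy K q (substY K uᵏ (P (suc n ∸ k)))
        ≈⟨ ⊙ₚ-congˡ cₖ (Dy-substY q uᵏ (P (suc n ∸ k))) ⟩
      cₖ ⊙ₚ uᵏ ⊙ₚ substY K uᵏ (Dy K q (P (suc n ∸ k)))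
        ≈⟨ ⊙ₚ-assoc cₖ uᵏ _ ⟨
      cₖ * uᵏ ⊙ₚ substY K uᵏ (Dy K q (P (suc n ∸ k)))
        ≈⟨ ⊙ₚ-congˡ _ (substY-cong uᵏ (Dy-P (+-∸-assoc 1 k≤n))) ⟩
      cₖ * uᵏ ⊙ₚ substY K uᵏ ([ suc n ∸ k ]q ⊙ₚ substY K u (P (n ∸ k)))
        ≈⟨ ⊙ₚ-congˡ _ (substY-⊙ₚ uᵏ _ _) ⟩
      cₖ * uᵏ ⊙ₚ [ suc n ∸ k ]q ⊙ₚ substY K uᵏ (substY K u (P (n ∸ k)))
        ≈⟨ ⊙ₚ-assoc _ _ _ ⟨
      cₖ * uᵏ * [ suc n ∸ k ]q ⊙ₚ substY K uᵏ (substY K u (P (n ∸ k)))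
        ≈⟨ ⊙ₚ-congˡ _ (substY-substY uᵏ u _) ⟩
      cₖ * uᵏ * [ suc n ∸ k ]q ⊙ₚ substY K (pow K u (suc k)) (P (n ∸ k))
        ≈⟨ ⊙ₚ-congʳ _ scalars ⟩
      qfall K q (suc n) (suc k) * pow K u (choose2 (suc k)) ⊙ₚ substY K (pow K u (suc k)) (P (n ∸ k)) ∎
      where
      open ≈ₚ-Reasoning
      open CommutativeMonoidSolver *-commutativeMonoid using (solve; _⊕_; _⊜_)
      uᵏ cₖ : Carrier
      uᵏ = pow K u k
      cₖ = qfall K q (suc n) k * pow K u (choose2 k)
      scalars : cₖ * uᵏ * [ suc n ∸ k ]q ≈ qfall K q (suc n) (suc k) * pow K u (choose2 (suc k))
      scalars = trans
        (solve 4 (λ f U v Q → ((f ⊕ U) ⊕ v) ⊕ Q ⊜ (f ⊕ Q) ⊕ (v ⊕ U)) refl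
               (qfall K q (suc n) k) (pow K u (choose2 k)) uᵏ [ suc n ∸ k ]q)
        (*-congˡ (sym (pow-homo-* u k (choose2 k))))

theorem7 : ∀ {c ℓ₁ ℓ₂} (K : HeytingField c ℓ₁ ℓ₂) →
    let open HeytingField K in
    (q u : Carrier) → q # 1# →
    (∀ n → 1 ≤ n → qint K q n # 0#) →
    (a : ℕ → Carrier) → a 0 # 0# →
    (P : ℕ → Poly2 K) →
    (A X Y PS : Series K) →
    (∀ n → _≈P_ K (_⊙_ K (qfact K q n) (A n)) (mono K (a n) 0 0)) →
    (∀ n → _≈P_ K (_⊙_ K (qfact K q n) (X n)) (mono K 1# n 0)) →
    (∀ n → _≈P_ K (_⊙_ K (qfact K q n) (Y n)) (mono K (pow K u (choose2 n)) 0 n)) →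
    (∀ n → _≈P_ K (_⊙_ K (qfact K q n) (PS n)) (P n)) →
    (∀ n → _≈P_ K (PS n) (_⋆_ K (_⋆_ K A X) Y n)) →
    ∀ n k → k ≤ n →
      _≈P_ K (iter K k (Dx K q) (P n))
             (_⊙_ K (qfall K q n k) (P (n ∸ k)))
      ×
      _≈P_ K (iter K k (Dy K q) (P n))
             (_⊙_ K (qfall K q n k * pow K u (choose2 k)) (substY K (pow K u k) (P (n ∸ k))))
theorem7 K q u _ qint#0 a _ P A X Y PS A-def X-def Y-def P-def PS-def n k k≤n =
  iter-Dx-P n k k≤n , iter-Dy-P n k k≤n
  where open Appell K q u qint#0 a P A X Y PS A-def X-def Y-def P-def PS-def
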